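{- Let $r\ge 2$ and $s,t\ge 2r$ be integers. Then for every positive integer $n$ there exists a red/blue edge-coloring of the Kneser graph $\mathrm{KG}(n,r)$ containing no red induced $\mathrm{KG}(s,r)$ and no blue induced $\mathrm{KG}(t,r)$. In other words, the induced $r$-Kneser Ramsey number $IR^{\mathrm{KG}}_r(s,t)$ does not exist.
   Context: The Kneser graph $\mathrm{KG}(n,r)$ has vertex set the $r$-element subsets of $[n]=\{1,\dots,n\}$, with two sets adjacent iff they are disjoint. An induced $\mathrm{KG}(s,r)$ in $\mathrm{KG}(n,r)$ is the subgraph induced on $\binom{S}{r}$ (all $r$-subsets of $S$) for some $S\subseteq[n]$ with $|S|=s$; it is red (resp. blue) if all of its edges are red (resp. blue). The induced $r$-Kneser Ramsey number $IR^{\mathrm{KG}}_r(s,t)$ is the minimum $n$, if it exists, such that every red/blue edge-coloring of $\mathrm{KG}(n,r)$ contains a red induced $\mathrm{KG}(s,r)$ or a blue induced $\mathrm{KG}(t,r)$. -}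

module Defs where

open import Data.Nat using (ℕ)
open import Data.Bool using (Bool; true; false)
open import Data.Fin.Subset using (Subset; _∩_; _⊆_; Empty; ∣_∣)
open import Relation.Binary.PropositionalEquality using (_≡_)
open import Data.Product using (Σ; _×_)
open import Relation.Nullary using (¬_)

data Colour : Set where
  red blue : Colour

-- Vertices of KG(n,r): r-element subsets of [n] (as Subset n).
-- Adjacency: disjointness.
Disjoint : ∀ {n} → Subset n → Subset n → Set
Disjoint A B = Empty (A ∩ B)

-- An edge-colouring of KG(n,r): a colour assigned to each ordered pair of
-- vertices, symmetric on edges (so it is really a colouring of unordered edges).
-- Values on non-edges / non-vertices are irrelevant.
record EdgeColouring (n r : ℕ) : Set where
  field
    colour : Subset n → Subset n → Colour
    symmetric : ∀ (A B : Subset n) → ∣ A ∣ ≡ r → ∣ B ∣ ≡ r → Disjoint A B →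
                colour A B ≡ colour B A
open EdgeColouring public

MonoInduced : ∀ {n r} → EdgeColouring n r → Colour → Subset n → Set
MonoInduced {n} {r} c k S =
  ∀ (A B : Subset n) → ∣ A ∣ ≡ r → ∣ B ∣ ≡ r → A ⊆ S → B ⊆ S → Disjoint A B →
  colour c A B ≡ k

HasRedInduced : ∀ {n r} → EdgeColouring n r → ℕ → Set
HasRedInduced {n} c s = Σ (Subset n) λ S → ∣ S ∣ ≡ s × MonoInduced c red S

HasBlueInduced : ∀ {n r} → EdgeColouring n r → ℕ → Set
HasBlueInduced {n} c t = Σ (Subset n) λ S → ∣ S ∣ ≡ t × MonoInduced c blue S

-- Colour an edge {A, B} red when the least and the greatest element of A ∪ B
-- lie in the same set, blue otherwise.  Any s ≥ 2r points contain a blue edge: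
-- the r smallest points against the r largest.  Any t ≥ 2r points contain a
-- red edge: A = the smallest point together with the r − 1 largest ones, B =
-- the r points in between; this needs r − 1 ≥ 1, i.e. r ≥ 2.
module Submission where

open import Defs
open import Data.Nat using (ℕ; _≤_; _*_; suc)
open import Data.Product using (Σ; _×_)
open import Relation.Nullary using (¬_)

open import Data.Nat using (_+_; z≤n; s≤s; s≤s⁻¹)
open import Data.Nat.Properties using (+-identityʳ; +-suc; ≤-trans; ≤-reflexive)
open import Data.Bool using (Bool; true; false; not; if_then_else_)
import Data.Bool.Properties as Bool
open import Data.Vec using ([]; _∷_; here; there)
open import Data.Fin using (zero)
open import Data.Fin.Subset using (Subset; _⊆_; ∣_∣)
open import Data.List using (List; []; _∷_; _++_; foldr; map; replicate; length)
open import Data.List.Properties using (map-++; map-replicate; foldr-++)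
open import Data.Product using (_,_; swap)
open import Data.Product.Properties using (≡-dec)
open import Function using (id)
open import Relation.Nullary using (yes; no; contradiction; ⌊_⌋)
open import Relation.Binary.Definitions using (DecidableEquality)
open import Relation.Binary.PropositionalEquality
  using (_≡_; _≢_; refl; sym; trans; cong; cong₂; module ≡-Reasoning)

-- The memberships (in A, in B) of a point of [n].
Side : Set
Side = Bool × Bool

pattern none = false , false

_≟_ : DecidableEquality Side
_≟_ = ≡-dec Bool._≟_ Bool._≟_

firstStep : Side → Side → Side
firstStep none l = l
firstStep p    _ = p

lastStep : Side → Side → Side
lastStep p none = p
lastStep _ l    = l

-- The side of the least / greatest point carrying a side other than none.
first last : List Side → Side
first = foldr firstStep none
last  = foldr lastStep none

firstStep-swap : ∀ p l → firstStep (swap p) (swap l) ≡ swap (firstStep p l)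
firstStep-swap (false , false) l = refl
firstStep-swap (false , true)  l = refl
firstStep-swap (true  , false) l = refl
firstStep-swap (true  , true)  l = refl

lastStep-swap : ∀ p l → lastStep (swap p) (swap l) ≡ swap (lastStep p l)
lastStep-swap p (false , false) = refl
lastStep-swap p (false , true)  = refl
lastStep-swap p (true  , false) = refl
lastStep-swap p (true  , true)  = refl

lastStep-none : ∀ l → lastStep none l ≡ l
lastStep-none (false , false) = refl
lastStep-none (false , true)  = refl
lastStep-none (true  , false) = refl
lastStep-none (true  , true)  = refl

lastStep-absorbs : ∀ p {l} → l ≢ none → lastStep p l ≡ l
lastStep-absorbs p {false , false} l≢none = contradiction refl l≢none
lastStep-absorbs p {false , true}  _ = refl
lastStep-absorbs p {true  , false} _ = refl
lastStep-absorbs p {true  , true}  _ = refl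

foldr-map-swap : (step : Side → Side → Side) →
  (∀ p l → step (swap p) (swap l) ≡ swap (step p l)) →
  ∀ ps → foldr step none (map swap ps) ≡ swap (foldr step none ps)
foldr-map-swap step step-swap []       = refl
foldr-map-swap step step-swap (p ∷ ps) =
  trans (cong (step (swap p)) (foldr-map-swap step step-swap ps)) (step-swap p _)

foldr-lastStep-absorbs : ∀ ps {l} → l ≢ none → foldr lastStep l ps ≡ l
foldr-lastStep-absorbs []       _      = refl
foldr-lastStep-absorbs (p ∷ ps) l≢none =
  trans (cong (lastStep p) (foldr-lastStep-absorbs ps l≢none)) (lastStep-absorbs p l≢none)

last-++-replicate : ∀ ps k p → p ≢ none → last (ps ++ replicate (suc k) p) ≡ p
last-++-replicate ps k p p≢none = begin
  last (ps ++ replicate (suc k) p)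
    ≡⟨ foldr-++ lastStep none ps _ ⟩
  foldr lastStep (last (replicate (suc k) p)) ps
    ≡⟨ cong (λ l → foldr lastStep l ps) (last-replicate k) ⟩
  foldr lastStep p ps
    ≡⟨ foldr-lastStep-absorbs ps p≢none ⟩
  p ∎
  where
  open ≡-Reasoning
  last-replicate : ∀ k → last (replicate (suc k) p) ≡ p
  last-replicate 0       = refl
  last-replicate (suc k) =
    trans (cong (lastStep p) (last-replicate k)) (lastStep-absorbs p p≢none)

colourOfEnds : Side → Side → Colour
colourOfEnds l m = if ⌊ l ≟ m ⌋ then red else blue

colourOfEnds-swap : ∀ l m → colourOfEnds (swap l) (swap m) ≡ colourOfEnds l m
colourOfEnds-swap l m with l ≟ m | swap l ≟ swap m
... | yes _   | yes _   = refl
... | no _    | no _    = refl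
... | yes l≡m | no sl≢sm = contradiction (cong swap l≡m) sl≢sm
... | no l≢m  | yes sl≡sm = contradiction (cong swap sl≡sm) l≢m

profileColour : List Side → Colour
profileColour ps = colourOfEnds (first ps) (last ps)

profileColour-map-swap : ∀ ps → profileColour (map swap ps) ≡ profileColour ps
profileColour-map-swap ps = begin
  colourOfEnds (first (map swap ps)) (last (map swap ps))
    ≡⟨ cong₂ colourOfEnds (foldr-map-swap firstStep firstStep-swap ps)
                          (foldr-map-swap lastStep lastStep-swap ps) ⟩
  colourOfEnds (swap (first ps)) (swap (last ps))
    ≡⟨ colourOfEnds-swap (first ps) (last ps) ⟩
  colourOfEnds (first ps) (last ps) ∎
  where open ≡-Reasoning

profile : ∀ {n} → Subset n → Subset n → List Side
profile []      []      = []
profile (x ∷ A) (y ∷ B) = (x , y) ∷ profile A B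

profile-swap : ∀ {n} (A B : Subset n) → profile B A ≡ map swap (profile A B)
profile-swap []      []      = refl
profile-swap (x ∷ A) (y ∷ B) = cong ((y , x) ∷_) (profile-swap A B)

minMaxColouring : ∀ n r → EdgeColouring n r
minMaxColouring n r = record
  { colour    = λ A B → profileColour (profile A B)
  ; symmetric = λ A B _ _ _ → begin
      profileColour (profile A B)            ≡⟨ sym (profileColour-map-swap (profile A B)) ⟩
      profileColour (map swap (profile A B)) ≡⟨ cong profileColour (sym (profile-swap A B)) ⟩
      profileColour (profile B A)            ∎
  }
  where open ≡-Reasoning

countᵇ : ∀ {a} {X : Set a} → (X → Bool) → List X → ℕ
countᵇ p []       = 0
countᵇ p (x ∷ xs) = if p x then suc (countᵇ p xs) else countᵇ p xs

countᵇ-++ : ∀ {a} {X : Set a} (p : X → Bool) xs ys →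
  countᵇ p (xs ++ ys) ≡ countᵇ p xs + countᵇ p ys
countᵇ-++ p []       ys = refl
countᵇ-++ p (x ∷ xs) ys with p x
... | true  = cong suc (countᵇ-++ p xs ys)
... | false = countᵇ-++ p xs ys

countᵇ-replicate : ∀ {a} {X : Set a} (p : X → Bool) k x →
  countᵇ p (replicate k x) ≡ (if p x then k else 0)
countᵇ-replicate p 0       x with p x
... | true  = refl
... | false = refl
countᵇ-replicate p (suc k) x with p x | countᵇ-replicate p k x
... | true  | ih = cong suc ih
... | false | ih = ih

length≡countᵇ+countᵇ-not : (xs : List Bool) → length xs ≡ countᵇ id xs + countᵇ not xs
length≡countᵇ+countᵇ-not []           = refl
length≡countᵇ+countᵇ-not (true  ∷ xs) = cong suc (length≡countᵇ+countᵇ-not xs)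
length≡countᵇ+countᵇ-not (false ∷ xs) =
  trans (cong suc (length≡countᵇ+countᵇ-not xs))
        (sym (+-suc (countᵇ id xs) (countᵇ not xs)))

-- The i-th point of S (in increasing order) belongs to spread f S P iff f
-- holds at the i-th entry of P; points of S beyond length P are left out.
spread : ∀ {n} → (Bool → Bool) → Subset n → List Bool → Subset n
spread f []          _       = []
spread f (false ∷ S) P       = false ∷ spread f S P
spread f (true  ∷ S) []      = false ∷ spread f S []
spread f (true  ∷ S) (x ∷ P) = f x ∷ spread f S P

spread-⊆ : ∀ {n} f (S : Subset n) P → spread f S P ⊆ S
spread-⊆ f (false ∷ S) P       (there i∈) = there (spread-⊆ f S P i∈)
spread-⊆ f (true  ∷ S) []      (there i∈) = there (spread-⊆ f S [] i∈)
spread-⊆ f (true  ∷ S) (x ∷ P) {zero} _   = here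
spread-⊆ f (true  ∷ S) (x ∷ P) (there i∈) = there (spread-⊆ f S P i∈)

spread-disjoint : ∀ {n} (S : Subset n) P → Disjoint (spread id S P) (spread not S P)
spread-disjoint (false ∷ S) P           (_ , there i∈) = spread-disjoint S P (_ , i∈)
spread-disjoint (true  ∷ S) []          (_ , there i∈) = spread-disjoint S [] (_ , i∈)
spread-disjoint (true  ∷ S) (true  ∷ P) (_ , there i∈) = spread-disjoint S P (_ , i∈)
spread-disjoint (true  ∷ S) (false ∷ P) (_ , there i∈) = spread-disjoint S P (_ , i∈)

∣spread∣ : ∀ {n} f (S : Subset n) P →
  length P ≤ ∣ S ∣ → ∣ spread f S P ∣ ≡ countᵇ f P
∣spread∣ f []          []      _ = refl
∣spread∣ f (false ∷ S) P       h = ∣spread∣ f S P h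
∣spread∣ f (true  ∷ S) []      _ = ∣spread∣ f S [] z≤n
∣spread∣ f (true  ∷ S) (x ∷ P) h with f x
... | true  = cong suc (∣spread∣ f S P (s≤s⁻¹ h))
... | false = ∣spread∣ f S P (s≤s⁻¹ h)

toSide : Bool → Side
toSide x = x , not x

foldr-profile-spread : ∀ {n} (step : Side → Side → Side) → (∀ l → step none l ≡ l) →
  (S : Subset n) (P : List Bool) → length P ≤ ∣ S ∣ →
  foldr step none (profile (spread id S P) (spread not S P)) ≡ foldr step none (map toSide P)
foldr-profile-spread step step-none []          []      _ = refl
foldr-profile-spread step step-none (false ∷ S) P       h =
  trans (step-none _) (foldr-profile-spread step step-none S P h)
foldr-profile-spread step step-none (true  ∷ S) []      _ =
  trans (step-none _) (foldr-profile-spread step step-none S [] z≤n)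
foldr-profile-spread step step-none (true  ∷ S) (x ∷ P) h =
  cong (step (toSide x)) (foldr-profile-spread step step-none S P (s≤s⁻¹ h))

monoInduced-pattern : ∀ {n r k} (S : Subset n) (P : List Bool) →
  2 * r ≤ ∣ S ∣ → countᵇ id P ≡ r → countᵇ not P ≡ r →
  MonoInduced (minMaxColouring n r) k S → k ≡ profileColour (map toSide P)
monoInduced-pattern {r = r} {k} S P 2r≤∣S∣ #A #B mono = begin
  k
    ≡⟨ sym edge-colour ⟩
  profileColour (profile (spread id S P) (spread not S P))
    ≡⟨ cong₂ colourOfEnds (foldr-profile-spread firstStep (λ _ → refl) S P P≤∣S∣)
                          (foldr-profile-spread lastStep lastStep-none S P P≤∣S∣) ⟩
  profileColour (map toSide P) ∎
  where
  open ≡-Reasoning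
  P≤∣S∣ : length P ≤ ∣ S ∣
  P≤∣S∣ = ≤-trans (≤-reflexive (begin
    length P                     ≡⟨ length≡countᵇ+countᵇ-not P ⟩
    countᵇ id P + countᵇ not P   ≡⟨ cong₂ _+_ #A (trans #B (sym (+-identityʳ r))) ⟩
    2 * r                        ∎)) 2r≤∣S∣
  edge-colour : profileColour (profile (spread id S P) (spread not S P)) ≡ k
  edge-colour = mono (spread id S P) (spread not S P)
    (trans (∣spread∣ id S P P≤∣S∣) #A) (trans (∣spread∣ not S P P≤∣S∣) #B)
    (spread-⊆ id S P) (spread-⊆ not S P) (spread-disjoint S P)

blueEdge : ℕ → List Bool
blueEdge r = replicate r true ++ replicate r false

-- The red edge for r = 2 + m.
redEdge : ℕ → List Bool
redEdge m = true ∷ replicate (2 + m) false ++ replicate (suc m) true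

countᵇ-replicate-++ : ∀ {a} {X : Set a} (p : X → Bool) i x j y →
  countᵇ p (replicate i x ++ replicate j y) ≡ (if p x then i else 0) + (if p y then j else 0)
countᵇ-replicate-++ p i x j y =
  trans (countᵇ-++ p (replicate i x) _)
        (cong₂ _+_ (countᵇ-replicate p i x) (countᵇ-replicate p j y))

map-++-replicate : ∀ {a b} {X : Set a} {Y : Set b} (f : X → Y) xs k x →
  map f (xs ++ replicate k x) ≡ map f xs ++ replicate k (f x)
map-++-replicate f xs k x =
  trans (map-++ f xs (replicate k x)) (cong (map f xs ++_) (map-replicate f k x))

countᵇ-id-blueEdge : ∀ r → countᵇ id (blueEdge r) ≡ r
countᵇ-id-blueEdge r = trans (countᵇ-replicate-++ id r true r false) (+-identityʳ r)

countᵇ-not-blueEdge : ∀ r → countᵇ not (blueEdge r) ≡ r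
countᵇ-not-blueEdge r = countᵇ-replicate-++ not r true r false

countᵇ-id-redEdge : ∀ m → countᵇ id (redEdge m) ≡ 2 + m
countᵇ-id-redEdge m = cong suc (countᵇ-replicate-++ id (2 + m) false (suc m) true)

countᵇ-not-redEdge : ∀ m → countᵇ not (redEdge m) ≡ 2 + m
countᵇ-not-redEdge m =
  trans (countᵇ-replicate-++ not (2 + m) false (suc m) true) (+-identityʳ (2 + m))

blueEdge-colour : ∀ m → profileColour (map toSide (blueEdge (suc m))) ≡ blue
blueEdge-colour m = begin
  profileColour (map toSide (blueEdge (suc m)))
    ≡⟨ cong profileColour (map-++-replicate toSide As (suc m) false) ⟩
  colourOfEnds (true , false) (last (map toSide As ++ replicate (suc m) (false , true)))
    ≡⟨ cong (colourOfEnds (true , false)) (last-++-replicate (map toSide As) m _ λ ()) ⟩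
  blue ∎
  where
  open ≡-Reasoning
  As : List Bool
  As = replicate (suc m) true

redEdge-colour : ∀ m → profileColour (map toSide (redEdge m)) ≡ red
redEdge-colour m = begin
  profileColour (map toSide (redEdge m))
    ≡⟨ cong (λ ps → profileColour (toSide true ∷ ps)) (map-++-replicate toSide Bs (suc m) true) ⟩
  colourOfEnds (true , false) (last (ps ++ replicate (suc m) (true , false)))
    ≡⟨ cong (colourOfEnds (true , false)) (last-++-replicate ps m _ λ ()) ⟩
  red ∎
  where
  open ≡-Reasoning
  Bs : List Bool
  Bs = replicate (2 + m) false
  ps : List Side
  ps = toSide true ∷ map toSide Bs

theorem4p1 : (r s t : ℕ) → 2 ≤ r → 2 * r ≤ s → 2 * r ≤ t →
    (n : ℕ) → 1 ≤ n →
    Σ (EdgeColouring n r) λ c → ¬ HasRedInduced c s × ¬ HasBlueInduced c t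
theorem4p1 (suc (suc m)) s t (s≤s (s≤s _)) 2r≤s 2r≤t n _ =
  minMaxColouring n r , noRed , noBlue
  where
  r : ℕ
  r = 2 + m
  red≢blue : red ≢ blue
  red≢blue ()
  noRed : ¬ HasRedInduced (minMaxColouring n r) s
  noRed (S , ∣S∣≡s , red-S) = red≢blue (trans
    (monoInduced-pattern S (blueEdge r) (≤-trans 2r≤s (≤-reflexive (sym ∣S∣≡s)))
      (countᵇ-id-blueEdge r) (countᵇ-not-blueEdge r) red-S)
    (blueEdge-colour (suc m)))
  noBlue : ¬ HasBlueInduced (minMaxColouring n r) t
  noBlue (S , ∣S∣≡t , blue-S) = red≢blue (sym (trans
    (monoInduced-pattern S (redEdge m) (≤-trans 2r≤t (≤-reflexive (sym ∣S∣≡t)))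
      (countᵇ-id-redEdge m) (countᵇ-not-redEdge m) blue-S)
    (redEdge-colour m)))
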